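{- Let $G=(V,E)$ be a finite connected graph that admits a perfect matching. Then $\eta(G)=0$ if and only if there is an edge $e\in E$ that is not contained in any perfect matching of $G$.
   Context: For a graph $G=(V,E)$ admitting a perfect matching, a weight function is a map $w:E\to\mathbb{R}_{\ge 0}$ that is not identically zero (zero weights are allowed, but at least one edge has positive weight). For $E'\subseteq E$ let $w(E')=\sum_{e\in E'}w(e)$. Let $M^*(G)$ denote a matching of $G$ of maximum weight and $P^*(G)$ a perfect matching of $G$ of maximum weight among all perfect matchings. Define $\eta(G)=\min_{w} \frac{w(P^*(G))}{w(M^*(G))}$, the minimum over all such weight functions $w$.
   Formalization: The weight functions $w$ in the definition of $\eta(G)$ take values in the nonnegative rationals rather than in $\mathbb{R}_{\ge 0}$. -}

module Defs where

open import Data.Nat using (ℕ)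
open import Data.Fin using (Fin) renaming (_<_ to _<ᶠ_)
open import Data.Bool using (Bool; true; false)
open import Data.Empty using (⊥)
open import Data.Product using (Σ; ∃; ∃-syntax; _×_; _,_; proj₁; proj₂)
open import Data.Sum using (_⊎_)
open import Data.List using (List; []; _∷_; foldr; map)
open import Data.List.Relation.Unary.Any using (Any)
open import Data.List.Relation.Unary.AllPairs using (AllPairs)
open import Data.List.Membership.Propositional using (_∈_; _∉_)
open import Data.Rational using (ℚ; 0ℚ; _+_; _≤_)
open import Relation.Binary.PropositionalEquality using (_≡_)
open import Relation.Nullary using (¬_)

record Graph (n : ℕ) : Set where
  field
    adj    : Fin n → Fin n → Bool
    sym    : ∀ u v → adj u v ≡ adj v u
    noLoop : ∀ v → adj v v ≡ false

open Graph public

module _ {n : ℕ} (G : Graph n) where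

  -- An edge {u,v} is represented uniquely as an ordered pair u < v with u ~ v.
  Edge : Set
  Edge = Σ (Fin n × Fin n) λ p → (proj₁ p <ᶠ proj₂ p) × (adj G (proj₁ p) (proj₂ p) ≡ true)

  data Walk : Fin n → Fin n → Set where
    here : ∀ {v} → Walk v v
    step : ∀ {u v w} → adj G u v ≡ true → Walk v w → Walk u w

  Connected : Set
  Connected = ∀ u v → Walk u v

  Incident : Fin n → Edge → Set
  Incident v e = (v ≡ proj₁ (proj₁ e)) ⊎ (v ≡ proj₂ (proj₁ e))

  Disjoint : Edge → Edge → Set
  Disjoint e f = ∀ v → Incident v e → Incident v f → ⊥

  -- A matching: a finite list of pairwise vertex-disjoint edges
  -- (this forces the edges to be distinct, so the list is a set of edges).
  IsMatching : List Edge → Set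
  IsMatching M = AllPairs Disjoint M

  IsPerfectMatching : List Edge → Set
  IsPerfectMatching M = IsMatching M × (∀ v → Any (Incident v) M)

  HasPerfectMatching : Set
  HasPerfectMatching = ∃[ M ] IsPerfectMatching M

  IsWeight : (Edge → ℚ) → Set
  IsWeight w = (∀ e → 0ℚ ≤ w e) × (∃[ e ] ¬ (w e ≡ 0ℚ))

  weight : (Edge → ℚ) → List Edge → ℚ
  weight w M = foldr (λ e s → w e + s) 0ℚ M

  IsMaxMatching : (Edge → ℚ) → List Edge → Set
  IsMaxMatching w M = IsMatching M × (∀ M' → IsMatching M' → weight w M' ≤ weight w M)

  IsMaxPerfectMatching : (Edge → ℚ) → List Edge → Set
  IsMaxPerfectMatching w P =
    IsPerfectMatching P × (∀ P' → IsPerfectMatching P' → weight w P' ≤ weight w P)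

  -- η(G) = 0: since each ratio w(P*)/w(M*) is ≥ 0 (and w(M*) > 0 for a nonzero
  -- nonnegative w), the minimum equals 0 exactly when some admissible weight
  -- function attains ratio 0, i.e. w(P*(G)) = 0.
  EtaZero : Set
  EtaZero = ∃[ w ] IsWeight w × ∃[ P ] ∃[ M ]
              IsMaxPerfectMatching w P × IsMaxMatching w M × (weight w P ≡ 0ℚ)

  HasEdgeInNoPerfectMatching : Set
  HasEdgeInNoPerfectMatching = ∃[ e ] (∀ P → IsPerfectMatching P → e ∉ P)

{-# OPTIONS --safe #-}
module Submission where

-- Forward: if w(P*) = 0 then every edge of every perfect matching has weight 0,
-- so any edge of positive weight lies in no perfect matching.
-- Backward: if e lies in no perfect matching, its indicator weight gives every
-- perfect matching weight 0, while the matching {e} has the maximum weight 1.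

open import Defs hiding (sym)
open import Data.Nat using (ℕ)
open import Data.Fin using (Fin) renaming (_<_ to _<ᶠ_)
open import Data.Fin.Properties using (_≟_; <-irrelevant)
open import Data.Bool using (true)
import Data.Bool.Properties as Bool
open import Data.Product using (_×_; _,_)
open import Data.Product.Properties using (≡-dec)
open import Data.Sum using (inj₁)
open import Data.List using ([]; _∷_)
open import Data.List.Relation.Unary.Any using (here; there)
open import Data.List.Relation.Unary.All as All using (All)
open import Data.List.Relation.Unary.AllPairs using ([]; _∷_)
open import Data.List.Membership.Propositional using (_∈_; _∉_)
open import Data.Rational using (ℚ; 0ℚ; 1ℚ; _+_; _≤_)
open import Data.Rational.Properties
  using (≤-refl; ≤-trans; ≤-antisym; ≤-reflexive; +-mono-≤; +-monoʳ-≤; +-identityˡ; +-identityʳ; nonNegative⁻¹; 1≢0)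
open import Function using (_∘_)
open import Function.Bundles using (_⇔_; mk⇔)
open import Relation.Binary.Definitions using (DecidableEquality)
open import Relation.Binary.PropositionalEquality
open import Relation.Nullary using (¬_; yes; no; contradiction)
open import Axiom.UniquenessOfIdentityProofs using (module Decidable⇒UIP)

module _ {n : ℕ} (G : Graph n) where

  _≟ₑ_ : DecidableEquality (Edge G)
  _≟ₑ_ = ≡-dec (≡-dec _≟_ _≟_) λ p q → yes (edge-evidence-irrelevant p q)
    where
    edge-evidence-irrelevant : ∀ {u v : Fin n} (p q : (u <ᶠ v) × (adj G u v ≡ true)) → p ≡ q
    edge-evidence-irrelevant (u<v , uv) (u<v′ , uv′) =
      cong₂ _,_ (<-irrelevant u<v u<v′) (Decidable⇒UIP.≡-irrelevant Bool._≟_ uv uv′)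

  ¬Disjoint-refl : ∀ e → ¬ Disjoint G e e
  ¬Disjoint-refl e disj = disj _ (inj₁ refl) (inj₁ refl)

  disjoint-from-all⇒∉ : ∀ {e L} → All (Disjoint G e) L → e ∉ L
  disjoint-from-all⇒∉ {e} disj e∈L = ¬Disjoint-refl e (All.lookup disj e∈L)

  module _ (w : Edge G → ℚ) (w≥0 : ∀ e → 0ℚ ≤ w e) where

    weight-nonneg : ∀ L → 0ℚ ≤ weight G w L
    weight-nonneg []      = ≤-refl
    weight-nonneg (f ∷ L) =
      subst (_≤ w f + weight G w L) (+-identityʳ 0ℚ) (+-mono-≤ (w≥0 f) (weight-nonneg L))

    ∈⇒≤-weight : ∀ {e L} → e ∈ L → w e ≤ weight G w L
    ∈⇒≤-weight {e} {f ∷ L} (here refl) =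
      subst (_≤ w e + weight G w L) (+-identityʳ (w e)) (+-monoʳ-≤ (w e) (weight-nonneg L))
    ∈⇒≤-weight {e} {f ∷ L} (there e∈L) =
      subst (_≤ w f + weight G w L) (+-identityˡ (w e)) (+-mono-≤ (w≥0 f) (∈⇒≤-weight e∈L))

  EtaZero⇒HasEdgeInNoPerfectMatching : EtaZero G → HasEdgeInNoPerfectMatching G
  EtaZero⇒HasEdgeInNoPerfectMatching
    (w , (w≥0 , e , we≢0) , P , _ , (_ , P-max) , _ , wP≡0) =
    e , λ P′ P′-perfect e∈P′ → we≢0 (≤-antisym
      (≤-trans (∈⇒≤-weight w w≥0 e∈P′) (subst (weight G w P′ ≤_) wP≡0 (P-max P′ P′-perfect)))
      (w≥0 e))

  indicator : Edge G → Edge G → ℚ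
  indicator e f with f ≟ₑ e
  ... | yes _ = 1ℚ
  ... | no  _ = 0ℚ

  module _ (e : Edge G) where

    indicator-self : indicator e e ≡ 1ℚ
    indicator-self with e ≟ₑ e
    ... | yes _   = refl
    ... | no  e≢e = contradiction refl e≢e

    indicator-nonneg : ∀ f → 0ℚ ≤ indicator e f
    indicator-nonneg f with f ≟ₑ e
    ... | yes _ = nonNegative⁻¹ 1ℚ
    ... | no  _ = ≤-refl

    weight-indicator-∉ : ∀ {L} → e ∉ L → weight G (indicator e) L ≡ 0ℚ
    weight-indicator-∉ {[]}    _   = refl
    weight-indicator-∉ {f ∷ L} e∉L with f ≟ₑ e
    ... | yes refl = contradiction (here refl) e∉L
    ... | no  _    = trans (+-identityˡ _) (weight-indicator-∉ (e∉L ∘ there))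

    weight-indicator-matching≤1 : ∀ {M} → IsMatching G M → weight G (indicator e) M ≤ 1ℚ
    weight-indicator-matching≤1 {[]}    _ = nonNegative⁻¹ 1ℚ
    weight-indicator-matching≤1 {f ∷ M} (f-disj ∷ M-matching) with f ≟ₑ e
    ... | yes refl = ≤-reflexive (trans (cong (1ℚ +_) (weight-indicator-∉ (disjoint-from-all⇒∉ f-disj)))
                                        (+-identityʳ 1ℚ))
    ... | no  _    = subst (_≤ 1ℚ) (sym (+-identityˡ _)) (weight-indicator-matching≤1 M-matching)

  HasEdgeInNoPerfectMatching⇒EtaZero :
    HasPerfectMatching G → HasEdgeInNoPerfectMatching G → EtaZero G
  HasEdgeInNoPerfectMatching⇒EtaZero (P , P-perfect) (e , e∉perfect) =
    indicator e , (indicator-nonneg e , e , λ we≡0 → 1≢0 (trans (sym (indicator-self e)) we≡0))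
    , P , e ∷ []
    , (P-perfect , λ P′ P′-perfect → ≤-reflexive (trans (weight-perfect≡0 P′-perfect) (sym (weight-perfect≡0 P-perfect))))
    , (All.[] ∷ [] , λ M M-matching → ≤-trans (weight-indicator-matching≤1 e M-matching)
                                          (≤-reflexive (sym weight-[e]≡1)))
    , weight-perfect≡0 P-perfect
    where
    weight-perfect≡0 : ∀ {P′} → IsPerfectMatching G P′ → weight G (indicator e) P′ ≡ 0ℚ
    weight-perfect≡0 P′-perfect = weight-indicator-∉ e (e∉perfect _ P′-perfect)

    weight-[e]≡1 : weight G (indicator e) (e ∷ []) ≡ 1ℚ
    weight-[e]≡1 = trans (cong (_+ 0ℚ) (indicator-self e)) (+-identityʳ 1ℚ)

theorem2p2 : ∀ (n : ℕ) (G : Graph n) → Connected G → HasPerfectMatching G →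
    (EtaZero G ⇔ HasEdgeInNoPerfectMatching G)
theorem2p2 n G _ has-perfect =
  mk⇔ (EtaZero⇒HasEdgeInNoPerfectMatching G) (HasEdgeInNoPerfectMatching⇒EtaZero G has-perfect)
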